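{- For every positive integer $n$, $\mathsf{tree}\text{ - }\alpha(L(K_n))=\alpha(L(K_n))=\lfloor n/2\rfloor$.
   Context: $K_n$ is the complete graph on $n$ vertices; $L(\cdot)$ denotes the line graph; $\alpha$ is the independence number. A tree decomposition of $G$ is a pair $(T,\beta)$ with $T$ a tree and $\beta:V(T)\to 2^{V(G)}$ such that every vertex lies in some bag, every edge has both endpoints in some bag, and for each vertex the nodes whose bags contain it induce a subtree. Its independence number is $\max_t\alpha(G[\beta(t)])$; $\mathsf{tree}\text{ - }\alpha(G)$ is the minimum independence number over all tree decompositions of $G$. -}

module Defs where

open import Level using (0ℓ)
open import Data.Nat using (ℕ; suc; _≤_; _<_)
open import Data.Fin using (Fin; toℕ)
open import Data.Product using (Σ; ∃; _×_; _,_; proj₁; proj₂)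
open import Data.Sum using (_⊎_)
open import Data.List using (List; length)
open import Data.List.Membership.Propositional using (_∈_)
open import Data.List.Relation.Unary.Unique.Propositional using (Unique)
open import Relation.Binary.PropositionalEquality using (_≡_; _≢_)
open import Relation.Nullary using (¬_)

record Graph : Set₁ where
  field
    V   : Set
    Adj : V → V → Set
open Graph public

-- A finite vertex subset, given as a list of vertices; its size is the
-- length of a duplicate-free list.
VSet : Graph → Set
VSet G = List (V G)

SubsetOf : (G : Graph) → VSet G → VSet G → Set
SubsetOf G S B = ∀ {v : V G} → v ∈ S → v ∈ B

IsIndependent : (G : Graph) → VSet G → Set
IsIndependent G S =
  Unique S × (∀ {u v : V G} → u ∈ S → v ∈ S → ¬ Adj G u v)

IsIndepNumberIn : (G : Graph) → VSet G → ℕ → Set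
IsIndepNumberIn G B k =
  (Σ (VSet G) λ S → SubsetOf G S B × IsIndependent G S × length S ≡ k)
  × (∀ (S : VSet G) → SubsetOf G S B → IsIndependent G S → length S ≤ k)

IsIndepNumber : (G : Graph) → ℕ → Set
IsIndepNumber G k =
  Σ (VSet G) λ all → Unique all × (∀ v → v ∈ all) × IsIndepNumberIn G all k

-- A tree on nodes Fin (suc m) is given by a parent map:
-- node (suc i) has parent (parent i), whose index is ≤ i.  Every finite
-- tree is isomorphic to one of this form (root it and number the nodes
-- in BFS order), and every such parent map yields a tree.

record Tree : Set where
  field
    m      : ℕ
    parent : Fin m → Fin (suc m)
    parent< : ∀ i → toℕ (parent i) ≤ toℕ i
open Tree public

Node : Tree → Set
Node T = Fin (suc (m T))

TreeAdj : (T : Tree) → Node T → Node T → Set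
TreeAdj T s t =
  (Σ (Fin (m T)) λ i → s ≡ Fin.suc i × t ≡ parent T i)
  ⊎ (Σ (Fin (m T)) λ i → t ≡ Fin.suc i × s ≡ parent T i)
  where import Data.Fin as Fin

data WalkIn (T : Tree) (P : Node T → Set) : Node T → Node T → Set where
  here : ∀ {s} → P s → WalkIn T P s s
  step : ∀ {s u t} → P s → TreeAdj T s u → WalkIn T P u t → WalkIn T P s t

InducesSubtree : (T : Tree) → (Node T → Set) → Set
InducesSubtree T P = ∀ s t → P s → P t → WalkIn T P s t

record TreeDecomposition (G : Graph) : Set₁ where
  field
    tree : Tree
    bag  : Node tree → VSet G
    vertexCovered : ∀ v → Σ (Node tree) λ t → v ∈ bag t
    edgeCovered   : ∀ u v → Adj G u v →
                    Σ (Node tree) λ t → u ∈ bag t × v ∈ bag t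
    subtree       : ∀ v → InducesSubtree tree (λ t → v ∈ bag t)
open TreeDecomposition public

IsTDIndepNumber : (G : Graph) → TreeDecomposition G → ℕ → Set
IsTDIndepNumber G D k =
  (∀ t → Σ ℕ λ a → IsIndepNumberIn G (bag D t) a × a ≤ k)
  × (Σ (Node (tree D)) λ t → IsIndepNumberIn G (bag D t) k)

IsTreeAlpha : (G : Graph) → ℕ → Set₁
IsTreeAlpha G k =
  (Σ (TreeDecomposition G) λ D → IsTDIndepNumber G D k)
  × (∀ (D : TreeDecomposition G) (j : ℕ) → IsTDIndepNumber G D j → k ≤ j)

LKEdge : ℕ → Set
LKEdge n = Σ (Fin n × Fin n) λ p → toℕ (proj₁ p) < toℕ (proj₂ p)

ShareEndpoint : ∀ {n} → LKEdge n → LKEdge n → Set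
ShareEndpoint ((a , b) , _) ((c , d) , _) =
  (a ≡ c) ⊎ (a ≡ d) ⊎ (b ≡ c) ⊎ (b ≡ d)

LineGraphK : ℕ → Graph
LineGraphK n = record
  { V   = LKEdge n
  ; Adj = λ e f → e ≢ f × ShareEndpoint e f
  }

-- Independent sets of L(Kₙ) are matchings of Kₙ, so α(L(Kₙ)) ≤ ⌊n/2⌋, and a
-- maximum matching attains it.  For tree-α, fix a tree decomposition and let
-- k = ⌊n/2⌋.  The edges at a vertex v form a clique of L(Kₙ), so by the Helly
-- property of subtrees one bag, at a node hub(v), contains all of them.  Pick a
-- node t whose subtree holds the hubs of at least n − k vertices while the
-- subtree of every child of t holds fewer.  Classify the vertices by where
-- their hub lies: outside the subtree of t, below a given child of t, or at t.
-- Each class has at most k vertices, and an edge uv between different classes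
-- lies in the bag of t, since the subtree of bags containing uv joins hub(u) to
-- hub(v) and so passes through t.  Sorting the vertices by class and pairing
-- the i-th with the (i+k)-th gives a matching of size k inside that bag.

module Submission where

open import Defs
open import Level using (0ℓ)
open import Data.Nat using (ℕ; zero; suc; _≤_; _<_; _+_; _*_; _∸_; _⊓_; _/_; _%_; z≤n; s≤s; _≤?_; _<?_)
import Data.Nat as ℕ
open import Data.Nat.Properties
  using ( ≤-refl; ≤-trans; ≤-antisym; ≤-reflexive; ≤-pred; <-irrefl; <⇒≤; ≰⇒>; n≤0⇒n≡0
        ; <-irrelevant; <-cmp; +-suc; +-comm; +-identityʳ; *-suc; *-comm; +-mono-≤
        ; m≤m+n; m≤n+m; m+n∸m≡n; m∸n≤m; ∸-monoˡ-≤; ∸-monoʳ-≤; m∸[m∸n]≡n; m≤n⇒m⊓n≡m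
        ; ≤-decTotalOrder; module ≤-Reasoning )
open import Data.Nat.DivMod using (m≡m%n+[m/n]*n; m%n<n; m*n/n≡m; /-monoˡ-≤)
open import Data.Fin using (Fin; toℕ; zero; suc; _≟_; join; splitAt)
import Data.Fin as Fin
open import Data.Fin.Properties using (toℕ-injective; splitAt-join)
open import Data.Fin.Induction using (<-wellFounded)
open import Data.Product using (Σ; ∃; _×_; _,_; proj₁; proj₂; uncurry)
open import Data.Sum using (_⊎_; inj₁; inj₂; [_,_]′)
open import Data.Empty using (⊥-elim)
open import Data.List
  using (List; []; _∷_; length; filter; map; _++_; zip; take; drop; concatMap; allFin; cartesianProduct)
open import Data.List.Properties
  using ( length-++; length-tabulate; length-zipWith; length-take; length-drop
        ; filter-accept; filter-all; drop-drop; take++drop≡id )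
open import Data.List.Membership.Propositional using (_∈_; _∉_; find; lose)
open import Data.List.Membership.Propositional.Properties
  using ( ∈-∃++; ∈-++⁻; ∈-++⁺ˡ; ∈-++⁺ʳ; ∈-filter⁺; ∈-filter⁻; ∈-allFin
        ; ∈-cartesianProduct⁺; ∈-concatMap⁺; ∈-concatMap⁻ )
import Data.List.Membership.DecPropositional as DecMembership
open import Data.List.Relation.Unary.Any using (here; there)
open import Data.List.Relation.Unary.All using (All; []; _∷_)
import Data.List.Relation.Unary.All as All
import Data.List.Relation.Unary.All.Properties as All
open import Data.List.Relation.Unary.AllPairs using (AllPairs; []; _∷_)
open import Data.List.Relation.Unary.Linked.Properties using (Linked⇒AllPairs)
open import Data.List.Relation.Unary.Unique.Propositional using (Unique)
import Data.List.Relation.Unary.Unique.Propositional.Properties as Unique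
open import Data.List.Relation.Binary.Subset.Propositional using (_⊆_)
import Data.List.Relation.Binary.Sublist.Propositional as Sublist
import Data.List.Relation.Binary.Sublist.Propositional.Properties as Sublist
open import Data.List.Relation.Binary.Permutation.Propositional
  using (_↭_; ↭-refl; ↭-sym; ↭-swap; prep; ↭⇒↭ₛ)
open import Data.List.Relation.Binary.Permutation.Propositional.Properties
  using (shift; ∈-resp-↭; ↭-length; filter-↭; ++⁺)
import Data.List.Relation.Binary.Permutation.Setoid.Properties as PermutationSetoid
import Data.List.Sort as Sort
open import Data.List.Extrema.Nat
  using (argmin; argmax; argmin-all; argmax-all; argmax-sel; f[argmin]≤f[xs]; f[xs]≤f[argmax]; f[⊥]≤f[argmax])
open import Induction.WellFounded using (Acc; acc)
open import Relation.Binary using (DecidableEquality; tri<; tri≈; tri>)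
import Relation.Binary.Construct.On as On
open import Relation.Binary.PropositionalEquality
  using (_≡_; _≢_; refl; sym; trans; cong; cong₂; subst; setoid; module ≡-Reasoning)
open import Relation.Nullary using (¬_; Dec; yes; no; ¬?)
open import Relation.Unary using (Pred; Decidable; Irrelevant)
import Relation.Unary as U
open import Function using (_∘_; _on_; id; case_of_)

-- Counting and pairing in lists

module _ {A : Set} where

  unique-⊆⇒length≤ : ∀ {xs ys : List A} → Unique xs → xs ⊆ ys → length xs ≤ length ys
  unique-⊆⇒length≤ {[]} _ _ = z≤n
  unique-⊆⇒length≤ {x ∷ xs} {ys} (x∉xs ∷ u) xs⊆ys with ∈-∃++ (xs⊆ys (here refl))
  ... | h , t , refl = subst (suc (length xs) ≤_) (sym length-h++x∷t)
                             (s≤s (unique-⊆⇒length≤ u xs⊆h++t))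
    where
    length-h++x∷t : length (h ++ x ∷ t) ≡ suc (length (h ++ t))
    length-h++x∷t = trans (length-++ h) (trans (+-suc (length h) (length t)) (cong suc (sym (length-++ h))))
    xs⊆h++t : xs ⊆ h ++ t
    xs⊆h++t {y} y∈xs with ∈-++⁻ h (xs⊆ys (there y∈xs))
    ... | inj₁ y∈h         = ∈-++⁺ˡ y∈h
    ... | inj₂ (here refl) = ⊥-elim (All.lookup x∉xs y∈xs refl)
    ... | inj₂ (there y∈t) = ∈-++⁺ʳ h y∈t

  Unique-resp-↭ : ∀ {xs ys : List A} → xs ↭ ys → Unique xs → Unique ys
  Unique-resp-↭ p = PermutationSetoid.Unique-resp-↭ (setoid A) (↭⇒↭ₛ p)

  count : {P : Pred A 0ℓ} → Decidable P → List A → ℕ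
  count P? xs = length (filter P? xs)

  count-mono : {P Q : Pred A 0ℓ} (P? : Decidable P) (Q? : Decidable Q) →
               P U.⊆ Q → ∀ xs → count P? xs ≤ count Q? xs
  count-mono P? Q? P⊆Q xs =
    Sublist.length-mono-≤ (Sublist.filter⁺ P? Q? (λ { refl → P⊆Q }) (Sublist.⊆-refl {x = xs}))

  count-∷ : {P : Pred A 0ℓ} (P? : Decidable P) → ∀ x xs → count P? xs ≤ count P? (x ∷ xs)
  count-∷ P? x xs = Sublist.length-mono-≤ (Sublist.filter⁺ P? P? (λ { refl → id }) (x Sublist.∷ʳ Sublist.⊆-refl))

  count-complement : {P : Pred A 0ℓ} (P? : Decidable P) →
                     ∀ xs → count P? xs + count (¬? ∘ P?) xs ≡ length xs
  count-complement P? [] = refl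
  count-complement P? (x ∷ xs) with P? x
  ... | yes _ = cong suc (count-complement P? xs)
  ... | no _  = trans (+-suc _ _) (cong suc (count-complement P? xs))

  count-singleton≤1 : {P : Pred A 0ℓ} (P? : Decidable P) (x : A) →
                      (∀ {y} → P y → y ≡ x) → ∀ {xs} → Unique xs → count P? xs ≤ 1
  count-singleton≤1 P? x only-x {xs} u =
    unique-⊆⇒length≤ {ys = x ∷ []} (Unique.filter⁺ P? u) (λ y∈ → here (only-x (proj₂ (∈-filter⁻ P? {xs = xs} y∈))))

  filterΣ : {P : Pred A 0ℓ} → Decidable P → List A → List (Σ A P)
  filterΣ P? [] = []
  filterΣ P? (x ∷ xs) with P? x
  ... | yes p = (x , p) ∷ filterΣ P? xs
  ... | no _  = filterΣ P? xs

  module _ {P : Pred A 0ℓ} (P? : Decidable P) where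

    ∈-filterΣ⁺ : Irrelevant P → ∀ {x xs} → x ∈ xs → (p : P x) → (x , p) ∈ filterΣ P? xs
    ∈-filterΣ⁺ irr {x} {y ∷ xs} (here refl) p with P? y
    ... | yes q = here (cong (x ,_) (irr p q))
    ... | no ¬p = ⊥-elim (¬p p)
    ∈-filterΣ⁺ irr {x} {y ∷ xs} (there x∈xs) p with P? y
    ... | yes _ = there (∈-filterΣ⁺ irr x∈xs p)
    ... | no _  = ∈-filterΣ⁺ irr x∈xs p

    map-proj₁-filterΣ : ∀ xs → map proj₁ (filterΣ P? xs) ≡ filter P? xs
    map-proj₁-filterΣ [] = refl
    map-proj₁-filterΣ (x ∷ xs) with P? x
    ... | yes _ = cong (x ∷_) (map-proj₁-filterΣ xs)
    ... | no _  = map-proj₁-filterΣ xs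

    filterΣ-unique : ∀ {xs} → Unique xs → Unique (filterΣ P? xs)
    filterΣ-unique {xs} u =
      Unique.map⁻ (subst Unique (sym (map-proj₁-filterΣ xs)) (Unique.filter⁺ P? u))

  drop-suc : ∀ k (xs : List A) {z rest} → drop k xs ≡ z ∷ rest → drop (suc k) xs ≡ rest
  drop-suc k xs xs-drop =
    trans (cong (λ m → drop m xs) (+-comm 1 k)) (trans (sym (drop-drop k 1 xs)) (cong (drop 1) xs-drop))

  unpair : List (A × A) → List A
  unpair = concatMap (λ (x , z) → x ∷ z ∷ [])

  unpair-zip-⊆ : ∀ xs zs → unpair (zip xs zs) ⊆ xs ++ zs
  unpair-zip-⊆ []       _        ()
  unpair-zip-⊆ (_ ∷ _)  []       ()
  unpair-zip-⊆ (x ∷ xs) (z ∷ zs) y∈ = ∈-resp-↭ (↭-sym (prep x (shift z xs zs))) (go y∈)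
    where
    go : ∀ {y} → y ∈ x ∷ z ∷ unpair (zip xs zs) → y ∈ x ∷ z ∷ (xs ++ zs)
    go (here refl)                = here refl
    go (there (here refl))        = there (here refl)
    go (there (there y∈xs⋈zs))    = there (there (unpair-zip-⊆ xs zs y∈xs⋈zs))

  unpair-zip-unique : ∀ xs zs → Unique (xs ++ zs) → Unique (unpair (zip xs zs))
  unpair-zip-unique []       _        _ = []
  unpair-zip-unique (_ ∷ _)  []       _ = []
  unpair-zip-unique (x ∷ xs) (z ∷ zs) u
    with (x∉ ∷ z∉ ∷ u′) ← Unique-resp-↭ (prep x (shift z xs zs)) u
    with (x≢z ∷ x∉xs++zs) ← x∉
    = (x≢z ∷ All.anti-mono (unpair-zip-⊆ xs zs) x∉xs++zs)
      ∷ All.anti-mono (unpair-zip-⊆ xs zs) z∉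
      ∷ unpair-zip-unique xs zs u′

  length-zip-take-drop : ∀ k (ys : List A) → k + k ≤ length ys → length (zip (take k ys) (drop k ys)) ≡ k
  length-zip-take-drop k ys 2k≤ = begin
    length (zip (take k ys) (drop k ys))           ≡⟨ length-zipWith _,_ (take k ys) (drop k ys) ⟩
    length (take k ys) ⊓ length (drop k ys)        ≡⟨ cong₂ _⊓_ (length-take k ys) (length-drop k ys) ⟩
    (k ⊓ length ys) ⊓ (length ys ∸ k)              ≡⟨ cong (_⊓ (length ys ∸ k)) (m≤n⇒m⊓n≡m (≤-trans (m≤m+n k k) 2k≤)) ⟩
    k ⊓ (length ys ∸ k)                            ≡⟨ m≤n⇒m⊓n≡m k≤ys∸k ⟩
    k                                              ∎
    where
    open ≡-Reasoning
    k≤ys∸k : k ≤ length ys ∸ k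
    k≤ys∸k = subst (_≤ length ys ∸ k) (m+n∸m≡n k k) (∸-monoˡ-≤ k 2k≤)

module _ {A : Set} (key : A → ℕ) where

  Sorted : List A → Set
  Sorted = AllPairs (λ a b → key a ≤ key b)

  hasKey? : ∀ c → Decidable (λ a → key a ≡ c)
  hasKey? c a = key a ℕ.≟ c

  multiplicity : ℕ → List A → ℕ
  multiplicity c = count (hasKey? c)

  multiplicity-∷ : ∀ {c y} ys → key y ≡ c → multiplicity c (y ∷ ys) ≡ suc (multiplicity c ys)
  multiplicity-∷ ys y≡c = cong length (filter-accept (hasKey? _) {xs = ys} y≡c)

  sorted-repeat⇒multiplicity : ∀ j {y ys z rest} → Sorted (y ∷ ys) → drop j ys ≡ z ∷ rest →
                               key z ≤ key y → 2 + j ≤ multiplicity (key y) (y ∷ ys)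
  sorted-repeat⇒multiplicity zero {y} {z ∷ rest} (y≤ ∷ _) refl z≤y = begin
    2                                         ≤⟨ s≤s (s≤s z≤n) ⟩
    2 + multiplicity (key y) rest             ≡⟨ cong suc (multiplicity-∷ rest z≡y) ⟨
    1 + multiplicity (key y) (z ∷ rest)       ≡⟨ multiplicity-∷ (z ∷ rest) refl ⟨
    multiplicity (key y) (y ∷ z ∷ rest)       ∎
    where
    open ≤-Reasoning
    z≡y = ≤-antisym z≤y (All.lookup y≤ (here refl))
  sorted-repeat⇒multiplicity (suc j) {y} {w ∷ ws} (y≤ ∷ w≤ ∷ sorted) ws-drop z≤y = begin
    3 + j                                     ≤⟨ s≤s (sorted-repeat⇒multiplicity j (w≤ ∷ sorted) ws-drop (≤-trans z≤y y≤w)) ⟩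
    1 + multiplicity (key w) (w ∷ ws)         ≡⟨ cong (λ c → suc (multiplicity c (w ∷ ws))) w≡y ⟩
    1 + multiplicity (key y) (w ∷ ws)         ≡⟨ multiplicity-∷ (w ∷ ws) refl ⟨
    multiplicity (key y) (y ∷ w ∷ ws)         ∎
    where
    open ≤-Reasoning
    y≤w = All.lookup y≤ (here refl)
    z∈ws = Sublist.Any-resp-⊆ (Sublist.drop-⊆ j ws) (subst (_ ∈_) (sym ws-drop) (here refl))
    w≡y = ≤-antisym (≤-trans (All.lookup w≤ z∈ws) z≤y) y≤w

  sorted-zip-keys-differ : ∀ k j ys → Sorted ys → (∀ y → multiplicity (key y) ys ≤ k) →
                           All (uncurry (_≢_ on key)) (zip (take j ys) (drop k ys))
  sorted-zip-keys-differ k       zero    ys       _ _ = []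
  sorted-zip-keys-differ k       (suc j) []       _ _ = []
  sorted-zip-keys-differ zero    (suc j) (y ∷ ys) _ mult≤0
    with () ← subst (_≤ 0) (multiplicity-∷ ys refl) (mult≤0 y)
  sorted-zip-keys-differ (suc k) (suc j) (y ∷ ys) (y≤ ∷ sorted) mult≤
    with drop k ys in ys-drop
  ... | []       = []
  ... | z ∷ rest = y≢z ∷ subst (λ zs → All _ (zip (take j ys) zs)) (drop-suc k ys ys-drop)
                               (sorted-zip-keys-differ (suc k) j ys sorted tail-mult≤)
    where
    y≢z : key y ≢ key z
    y≢z y≡z = <-irrefl refl (≤-trans (sorted-repeat⇒multiplicity k (y≤ ∷ sorted) ys-drop
                                          (≤-reflexive (sym y≡z))) (mult≤ y))
    tail-mult≤ : ∀ y′ → multiplicity (key y′) ys ≤ suc k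
    tail-mult≤ y′ = ≤-trans (count-∷ (hasKey? (key y′)) y ys) (mult≤ y′)

  disjoint-pairs-with-distinct-keys :
    ∀ k (xs : List A) → Unique xs → k + k ≤ length xs → (∀ y → multiplicity (key y) xs ≤ k) →
    Σ (List (A × A)) λ ps → length ps ≡ k × Unique (unpair ps) × All (uncurry (_≢_ on key)) ps
  disjoint-pairs-with-distinct-keys k xs unique 2k≤ mult≤ =
    zip (take k ys) (drop k ys)
    , length-zip-take-drop k ys (subst (k + k ≤_) (sym (↭-length ys↭xs)) 2k≤)
    , unpair-zip-unique (take k ys) (drop k ys)
        (subst Unique (sym (take++drop≡id k ys)) (Unique-resp-↭ (↭-sym ys↭xs) unique))
    , sorted-zip-keys-differ k k ys ys-sorted ys-mult≤
    where
    open Sort (On.decTotalOrder ≤-decTotalOrder key) using (sort; sort-↭; sort-↗)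
    ys = sort xs
    ys↭xs : ys ↭ xs
    ys↭xs = sort-↭ xs
    ys-sorted : Sorted ys
    ys-sorted = Linked⇒AllPairs ≤-trans (sort-↗ xs)
    ys-mult≤ : ∀ y → multiplicity (key y) ys ≤ k
    ys-mult≤ y = subst (_≤ k) (↭-length (filter-↭ (hasKey? (key y)) (↭-sym ys↭xs))) (mult≤ y)

length-allFin : ∀ n → length (allFin n) ≡ n
length-allFin n = length-tabulate id

-- Rooted trees and tree decompositions

module RootedTree (T : Tree) where

  data Below (c : Node T) : Node T → Set where
    self  : Below c c
    child : ∀ i → Below c (parent T i) → Below c (suc i)

  parent<child : ∀ i → parent T i Fin.< suc i
  parent<child i = s≤s (parent< T i)

  Below⇒≤ : ∀ {c x} → Below c x → toℕ c ≤ toℕ x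
  Below⇒≤ self          = ≤-refl
  Below⇒≤ (child i c≼p) = ≤-trans (Below⇒≤ c≼p) (<⇒≤ (parent<child i))

  Below-trans : ∀ {a b c} → Below a b → Below b c → Below a c
  Below-trans a≼b self          = a≼b
  Below-trans a≼b (child i b≼p) = child i (Below-trans a≼b b≼p)

  below-acc : ∀ c x → Acc Fin._<_ x → Dec (Below c x)
  below-acc c x _ with c ≟ x
  ... | yes refl = yes self
  below-acc c zero    _        | no c≢0 = no λ { self → c≢0 refl }
  below-acc c (suc i) (acc rs) | no c≢x with below-acc c (parent T i) (rs (parent<child i))
  ... | yes c≼p = yes (child i c≼p)
  ... | no c⋠p  = no λ { self → c≢x refl ; (child .i c≼p) → c⋠p c≼p }

  below? : ∀ c x → Dec (Below c x)
  below? c x = below-acc c x (<-wellFounded x)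

  root-above-acc : ∀ x → Acc Fin._<_ x → Below zero x
  root-above-acc zero    _        = self
  root-above-acc (suc i) (acc rs) = child i (root-above-acc (parent T i) (rs (parent<child i)))

  root-above : ∀ x → Below zero x
  root-above x = root-above-acc x (<-wellFounded x)

  module _ {P : Node T → Set} where

    walk-start : ∀ {x y} → WalkIn T P x y → P x
    walk-start (here px)     = px
    walk-start (step px _ _) = px

    edge-exit : ∀ i {s u} → P s → TreeAdj T s u → P u →
                Below (suc i) s → ¬ Below (suc i) u → P (suc i) × P (parent T i)
    edge-exit i ps (inj₁ (j , refl , refl)) pu self           _    = ps , pu
    edge-exit i ps (inj₁ (j , refl , refl)) pu (child .j i≼u) i⋠u = ⊥-elim (i⋠u i≼u)
    edge-exit i ps (inj₂ (j , refl , refl)) pu i≼s           i⋠u = ⊥-elim (i⋠u (child j i≼s))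

    walk-exit : ∀ i {x y} → WalkIn T P x y →
                Below (suc i) x → ¬ Below (suc i) y → P (suc i) × P (parent T i)
    walk-exit i (here _) i≼x i⋠y = ⊥-elim (i⋠y i≼x)
    walk-exit i (step {u = u} px x~u walk) i≼x i⋠y with below? (suc i) u
    ... | yes i≼u = walk-exit i walk i≼u i⋠y
    ... | no i⋠u  = edge-exit i px x~u (walk-start walk) i≼x i⋠u

    module _ (subtree : InducesSubtree T P) where

      subtree-exit : ∀ i {x y} → P x → P y →
                     Below (suc i) x → ¬ Below (suc i) y → P (suc i) × P (parent T i)
      subtree-exit i {x} {y} px py = walk-exit i (subtree x y px py)

      minimum-above : ∀ {r} → P r → (∀ {x} → P x → toℕ r ≤ toℕ x) → ∀ {x} → P x → Below r x
      minimum-above {zero}  _  _      {x} _  = root-above x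
      minimum-above {suc i} pr lowest {x} px with below? (suc i) x
      ... | yes i≼x = i≼x
      ... | no i⋠x  = ⊥-elim (<-irrefl refl (≤-trans (lowest p) (parent< T i)))
        where p = proj₂ (subtree-exit i pr px self i⋠x)

      ancestor-in-subtree : ∀ {r s x} → P r → P x → Below s x → toℕ r ≤ toℕ s → P s
      ancestor-in-subtree {r} {s} pr px s≼x r≤s with s ≟ r
      ... | yes refl = pr
      ancestor-in-subtree {s = zero}  pr px s≼x r≤s | no s≢r =
        ⊥-elim (s≢r (sym (toℕ-injective (n≤0⇒n≡0 r≤s))))
      ancestor-in-subtree {s = suc i} pr px s≼x r≤s | no s≢r =
        proj₁ (subtree-exit i px pr s≼x (λ s≼r → s≢r (toℕ-injective (≤-antisym (Below⇒≤ s≼r) r≤s))))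

  child-above : ∀ {t x} → Below t x → x ≢ t → Σ (Fin (m T)) λ i → parent T i ≡ t × Below (suc i) x
  child-above self         x≢t = ⊥-elim (x≢t refl)
  child-above {t} (child j t≼p) x≢t with parent T j ≟ t
  ... | yes p≡t = j , p≡t , self
  ... | no p≢t with child-above t≼p p≢t
  ...   | i , pᵢ≡t , i≼p = i , pᵢ≡t , child j i≼p

  child⋠parent : ∀ j → ¬ Below (suc j) (parent T j)
  child⋠parent j j≼p = <-irrefl refl (≤-trans (Below⇒≤ j≼p) (parent< T j))

  siblings-disjoint : ∀ {i j x} → Below (suc i) x → Below (suc j) x → parent T i ≡ parent T j → i ≡ j
  siblings-disjoint self           self           _   = refl
  siblings-disjoint self           (child i j≼p)  p≡p = ⊥-elim (child⋠parent _ (subst (Below _) p≡p j≼p))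
  siblings-disjoint (child j i≼p)  self           p≡p = ⊥-elim (child⋠parent _ (subst (Below _) (sym p≡p) i≼p))
  siblings-disjoint (child k i≼p)  (child .k j≼p) p≡p = siblings-disjoint i≼p j≼p p≡p

  above-child : ∀ {t} i → parent T i ≡ t → Below t (suc i)
  above-child i pᵢ≡t = subst (λ z → Below z (suc i)) pᵢ≡t (child i self)

  subtree-contains-parent : ∀ {P t} → InducesSubtree T P → ∀ {x y} → P x → P y → ∀ i → parent T i ≡ t →
                            Below (suc i) x → ¬ Below (suc i) y → P t
  subtree-contains-parent {P} subtree px py i pᵢ≡t i≼x i⋠y =
    subst P pᵢ≡t (proj₂ (subtree-exit subtree i px py i≼x i⋠y))

  data Position (t x : Node T) : Set where
    outside : ¬ Below t x → Position t x
    inside  : ∀ i → parent T i ≡ t → Below (suc i) x → Position t x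
    centre  : x ≡ t → Position t x

  locate : ∀ t x → Position t x
  locate t x with x ≟ t
  ... | yes x≡t = centre x≡t
  ... | no x≢t with below? t x
  ...   | no t⋠x  = outside t⋠x
  ...   | yes t≼x with child-above t≼x x≢t
  ...     | i , pᵢ≡t , i≼x = inside i pᵢ≡t i≼x

module Weights (T : Tree) {A : Set} (place : A → Node T) (xs : List A) where

  open RootedTree T

  weight : Node T → ℕ
  weight c = count (λ a → below? c (place a)) xs

  weight-root : weight zero ≡ length xs
  weight-root = cong length (filter-all (λ a → below? zero (place a)) {xs = xs} (All.tabulate (λ {a} _ → root-above (place a))))

  balanced-node : ∀ h → h ≤ length xs →
                  Σ (Node T) λ c → h ≤ weight c × (∀ i → parent T i ≡ c → weight (suc i) < h)
  balanced-node h h≤ = heaviest , heaviest-heavy , children-light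
    where
    heavy? : ∀ c → Dec (h ≤ weight c)
    heavy? c = h ≤? weight c
    heavy = filter heavy? (allFin _)
    heaviest = argmax toℕ zero heavy
    heaviest-heavy : h ≤ weight heaviest
    heaviest-heavy = argmax-all toℕ (subst (h ≤_) (sym weight-root) h≤) (All.all-filter heavy? (allFin _))
    children-light : ∀ i → parent T i ≡ heaviest → weight (suc i) < h
    children-light i pᵢ≡heaviest with heavy? (suc i)
    ... | no light = ≰⇒> light
    ... | yes child-heavy = ⊥-elim (<-irrefl refl (begin
      toℕ (suc i)          ≤⟨ All.lookup (f[xs]≤f[argmax] {f = toℕ} zero heavy) (∈-filter⁺ heavy? (∈-allFin (suc i)) child-heavy) ⟩
      toℕ heaviest         ≡⟨ cong toℕ pᵢ≡heaviest ⟨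
      toℕ (parent T i)     ≤⟨ parent< T i ⟩
      toℕ i                ∎))
      where open ≤-Reasoning

IsClique : (G : Graph) → List (V G) → Set
IsClique G K = ∀ {u v} → u ∈ K → v ∈ K → u ≢ v → Adj G u v

module CliqueInBag (G : Graph) (_≟ᵥ_ : DecidableEquality (V G)) (D : TreeDecomposition G) where

  open RootedTree (tree D)
  open DecMembership _≟ᵥ_ using (_∈?_)

  holders : V G → List (Node (tree D))
  holders v = filter (λ t → v ∈? bag D t) (allFin _)

  lowest : V G → Node (tree D)
  lowest v = argmin toℕ (proj₁ (vertexCovered D v)) (holders v)

  lowest-∈ : ∀ v → v ∈ bag D (lowest v)
  lowest-∈ v = argmin-all toℕ (proj₂ (vertexCovered D v)) (All.all-filter (λ t → v ∈? bag D t) (allFin _))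

  lowest-≤ : ∀ {v t} → v ∈ bag D t → toℕ (lowest v) ≤ toℕ t
  lowest-≤ {v} {t} v∈t = All.lookup (f[argmin]≤f[xs] {f = toℕ} (proj₁ (vertexCovered D v)) (holders v))
                                    (∈-filter⁺ (λ t → v ∈? bag D t) (∈-allFin t) v∈t)

  lowest-above : ∀ {v t} → v ∈ bag D t → Below (lowest v) t
  lowest-above {v} = minimum-above (subtree D v) (lowest-∈ v) lowest-≤

  clique-in-bag-of-highest : ∀ {K} → IsClique G K → ∀ {w} → w ∈ K →
                             (∀ {v} → v ∈ K → toℕ (lowest v) ≤ toℕ (lowest w)) →
                             ∀ {v} → v ∈ K → v ∈ bag D (lowest w)
  clique-in-bag-of-highest clique {w} w∈K highest {v} v∈K with v ≟ᵥ w
  ... | yes refl = lowest-∈ w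
  ... | no v≢w with edgeCovered D v w (clique v∈K w∈K v≢w)
  ...   | t , v∈t , w∈t =
    ancestor-in-subtree (subtree D v) (lowest-∈ v) v∈t (lowest-above w∈t) (highest v∈K)

  clique-in-bag : ∀ K → IsClique G K → Σ (Node (tree D)) λ t → ∀ {v} → v ∈ K → v ∈ bag D t
  clique-in-bag []       _      = zero , λ ()
  clique-in-bag (u ∷ us) clique = lowest w , clique-in-bag-of-highest clique w∈K w-highest
    where
    w = argmax (toℕ ∘ lowest) u us
    w∈K : w ∈ u ∷ us
    w∈K = [ here , there ]′ (argmax-sel (toℕ ∘ lowest) u us)
    w-highest : ∀ {v} → v ∈ u ∷ us → toℕ (lowest v) ≤ toℕ (lowest w)
    w-highest (here refl)  = f[⊥]≤f[argmax] {f = toℕ ∘ lowest} u us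
    w-highest (there v∈us) = All.lookup (f[xs]≤f[argmax] {f = toℕ ∘ lowest} u us) v∈us

-- The line graph of Kₙ

module _ {n : ℕ} where

  open DecMembership (_≟_ {n}) using (_∈?_)

  endpoints : LKEdge n → List (Fin n)
  endpoints ((a , b) , _) = a ∷ b ∷ []

  common-endpoint⇒share : ∀ {x} e f → x ∈ endpoints e → x ∈ endpoints f → ShareEndpoint e f
  common-endpoint⇒share _ _ (here refl)         (here refl)         = inj₁ refl
  common-endpoint⇒share _ _ (here refl)         (there (here refl)) = inj₂ (inj₁ refl)
  common-endpoint⇒share _ _ (there (here refl)) (here refl)         = inj₂ (inj₂ (inj₁ refl))
  common-endpoint⇒share _ _ (there (here refl)) (there (here refl)) = inj₂ (inj₂ (inj₂ refl))

  share⇒common-endpoint : ∀ e f → ShareEndpoint e f → ∃ λ x → x ∈ endpoints e × x ∈ endpoints f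
  share⇒common-endpoint ((a , _) , _) _ (inj₁ refl)                = a , here refl , here refl
  share⇒common-endpoint ((a , _) , _) _ (inj₂ (inj₁ refl))         = a , here refl , there (here refl)
  share⇒common-endpoint ((_ , b) , _) _ (inj₂ (inj₂ (inj₁ refl)))  = b , there (here refl) , here refl
  share⇒common-endpoint ((_ , b) , _) _ (inj₂ (inj₂ (inj₂ refl)))  = b , there (here refl) , there (here refl)

  share-sym : ∀ e f → ShareEndpoint e f → ShareEndpoint f e
  share-sym e f share with share⇒common-endpoint e f share
  ... | x , x∈e , x∈f = common-endpoint⇒share f e x∈f x∈e

  edge-≡ : ∀ {a b c d : Fin n} {a<b c<d} → a ≡ c → b ≡ d →
           _≡_ {A = LKEdge n} ((a , b) , a<b) ((c , d) , c<d)
  edge-≡ {a<b = a<b} {c<d} refl refl = cong (_ ,_) (<-irrelevant a<b c<d)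

  _≟ₑ_ : DecidableEquality (LKEdge n)
  ((a , b) , _) ≟ₑ ((c , d) , _) with a ≟ c | b ≟ d
  ... | yes a≡c | yes b≡d = yes (edge-≡ a≡c b≡d)
  ... | no a≢c  | _       = no λ { refl → a≢c refl }
  ... | yes _   | no b≢d  = no λ { refl → b≢d refl }

  allEdges : List (LKEdge n)
  allEdges = filterΣ (λ (a , b) → toℕ a <? toℕ b) (cartesianProduct (allFin n) (allFin n))

  ∈-allEdges : ∀ e → e ∈ allEdges
  ∈-allEdges ((a , b) , a<b) =
    ∈-filterΣ⁺ _ <-irrelevant (∈-cartesianProduct⁺ (∈-allFin a) (∈-allFin b)) a<b

  allEdges-unique : Unique allEdges
  allEdges-unique = filterΣ-unique _ (Unique.cartesianProduct⁺ (Unique.allFin⁺ n) (Unique.allFin⁺ n))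

  edge : (u v : Fin n) → u ≢ v → LKEdge n
  edge u v u≢v with <-cmp (toℕ u) (toℕ v)
  ... | tri< u<v _ _ = (u , v) , u<v
  ... | tri≈ _ u≡v _ = ⊥-elim (u≢v (toℕ-injective u≡v))
  ... | tri> _ _ v<u = (v , u) , v<u

  endpoints-edge : ∀ u v u≢v → endpoints (edge u v u≢v) ↭ u ∷ v ∷ []
  endpoints-edge u v u≢v with <-cmp (toℕ u) (toℕ v)
  ... | tri< _ _ _   = ↭-refl
  ... | tri≈ _ u≡v _ = ⊥-elim (u≢v (toℕ-injective u≡v))
  ... | tri> _ _ _   = ↭-swap v u ↭-refl

  incidentEdges : Fin n → List (LKEdge n)
  incidentEdges v = filter (λ e → v ∈? endpoints e) allEdges

  incident-∈-incidentEdges : ∀ {v} e → v ∈ endpoints e → e ∈ incidentEdges v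
  incident-∈-incidentEdges {v} e v∈e = ∈-filter⁺ (λ e → v ∈? endpoints e) (∈-allEdges e) v∈e

  incidentEdges-clique : ∀ v → IsClique (LineGraphK n) (incidentEdges v)
  incidentEdges-clique v {e} {f} e∈ f∈ e≢f = e≢f , common-endpoint⇒share e f (incident e∈) (incident f∈)
    where
    incident : ∀ {e} → e ∈ incidentEdges v → v ∈ endpoints e
    incident e∈ = proj₂ (∈-filter⁻ (λ e → v ∈? endpoints e) {xs = allEdges} e∈)

  allEndpoints : List (LKEdge n) → List (Fin n)
  allEndpoints = concatMap endpoints

  length-allEndpoints : ∀ S → length (allEndpoints S) ≡ 2 * length S
  length-allEndpoints []      = refl
  length-allEndpoints (_ ∷ S) = trans (cong (2 +_) (length-allEndpoints S)) (sym (*-suc 2 (length S)))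

  ∈-allEndpoints⁺ : ∀ {x f S} → f ∈ S → x ∈ endpoints f → x ∈ allEndpoints S
  ∈-allEndpoints⁺ f∈S x∈f = ∈-concatMap⁺ endpoints (lose f∈S x∈f)

  ∈-allEndpoints⁻ : ∀ {x} S → x ∈ allEndpoints S → ∃ λ f → f ∈ S × x ∈ endpoints f
  ∈-allEndpoints⁻ S x∈ = find (∈-concatMap⁻ endpoints {xs = S} x∈)

  independent⇒endpoints-unique : ∀ S → IsIndependent (LineGraphK n) S → Unique (allEndpoints S)
  independent⇒endpoints-unique []                       _                     = []
  independent⇒endpoints-unique (e@((a , b) , a<b) ∷ S) (e∉S ∷ unique , indep) =
    (a≢b ∷ unshared (here refl)) ∷ unshared (there (here refl))
      ∷ independent⇒endpoints-unique S (unique , λ u∈ v∈ → indep (there u∈) (there v∈))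
    where
    a≢b : a ≢ b
    a≢b refl = <-irrefl refl a<b
    unshared : ∀ {x} → x ∈ endpoints e → All (x ≢_) (allEndpoints S)
    unshared x∈e = All.tabulate λ y∈ x≡y → case ∈-allEndpoints⁻ S y∈ of λ where
      (f , f∈S , y∈f) → indep (here refl) (there f∈S)
        (All.lookup e∉S f∈S , common-endpoint⇒share e f x∈e (subst (_∈ endpoints f) (sym x≡y) y∈f))

  endpoints-unique⇒independent : ∀ S → Unique (allEndpoints S) → IsIndependent (LineGraphK n) S
  endpoints-unique⇒independent []      _ = [] , λ ()
  endpoints-unique⇒independent (e ∷ S) ((_ ∷ a∉) ∷ b∉ ∷ unique)
    with endpoints-unique⇒independent S unique
  ... | S-unique , S-indep = All.tabulate (λ f∈S e≡f → unshared f∈S (subst (ShareEndpoint e) e≡f self-share)) ∷ S-unique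
                           , indep
    where
    fresh : ∀ {x} → x ∈ endpoints e → x ∉ allEndpoints S
    fresh (here refl)         x∈S = All.lookup a∉ x∈S refl
    fresh (there (here refl)) x∈S = All.lookup b∉ x∈S refl
    self-share : ShareEndpoint e e
    self-share = common-endpoint⇒share e e (here refl) (here refl)
    unshared : ∀ {f} → f ∈ S → ¬ ShareEndpoint e f
    unshared {f} f∈S share with share⇒common-endpoint e f share
    ... | x , x∈e , x∈f = fresh x∈e (∈-allEndpoints⁺ f∈S x∈f)
    indep : ∀ {u v} → u ∈ e ∷ S → v ∈ e ∷ S → ¬ Adj (LineGraphK n) u v
    indep (here refl) (here refl) (e≢e , _)   = e≢e refl
    indep (here refl) (there v∈S) (_ , share) = unshared v∈S share
    indep {u} (there u∈S) (here refl) (_ , share) = unshared u∈S (share-sym u e share)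
    indep (there u∈S) (there v∈S) adj         = S-indep u∈S v∈S adj

  independent⇒2*length≤n : ∀ S → IsIndependent (LineGraphK n) S → 2 * length S ≤ n
  independent⇒2*length≤n S indep = begin
    2 * length S               ≡⟨ length-allEndpoints S ⟨
    length (allEndpoints S)    ≤⟨ unique-⊆⇒length≤ (independent⇒endpoints-unique S indep) (λ _ → ∈-allFin _) ⟩
    length (allFin n)          ≡⟨ length-allFin n ⟩
    n                          ∎
    where open ≤-Reasoning

  edges : (ps : List (Fin n × Fin n)) → All (uncurry _≢_) ps → List (LKEdge n)
  edges []             []          = []
  edges ((u , v) ∷ ps) (u≢v ∷ ds) = edge u v u≢v ∷ edges ps ds

  length-edges : ∀ ps ds → length (edges ps ds) ≡ length ps
  length-edges []      []       = refl
  length-edges (_ ∷ ps) (_ ∷ ds) = cong suc (length-edges ps ds)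

  allEndpoints-edges : ∀ ps ds → allEndpoints (edges ps ds) ↭ unpair ps
  allEndpoints-edges []             []          = ↭-refl
  allEndpoints-edges ((u , v) ∷ ps) (u≢v ∷ ds) = ++⁺ (endpoints-edge u v u≢v) (allEndpoints-edges ps ds)

  All-edges : ∀ {Q : LKEdge n → Set} ps ds → All (uncurry λ u v → (u≢v : u ≢ v) → Q (edge u v u≢v)) ps →
              All Q (edges ps ds)
  All-edges []             []          []          = []
  All-edges ((u , v) ∷ ps) (u≢v ∷ ds) (q ∷ qs) = q u≢v ∷ All-edges ps ds qs

-- A matching in a balanced bag

module BalancedBag (n k : ℕ) (2k≤n : k + k ≤ n) (n≤2k+1 : n ≤ suc (k + k)) (1≤k : 1 ≤ k)
                   (D : TreeDecomposition (LineGraphK n))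
                   (hub : Fin n → Node (tree D))
                   (hub-bag : ∀ {v} e → v ∈ endpoints e → e ∈ bag D (hub v))
                   (t : Node (tree D))
                   (t-heavy : n ∸ k ≤ Weights.weight (tree D) hub (allFin n) t)
                   (children-light : ∀ i → parent (tree D) i ≡ t → Weights.weight (tree D) hub (allFin n) (suc i) < n ∸ k)
                   where

  T = tree D
  open RootedTree T
  open Weights T hub (allFin n)

  Class : Set
  Class = Node T ⊎ Fin n

  -- The root labels the vertices whose hub lies outside the subtree of t; it
  -- cannot be confused with a child of t, which has the form suc i.
  classOf : ∀ v → Position t (hub v) → Class
  classOf _ (outside _)    = inj₁ zero
  classOf _ (inside i _ _) = inj₁ (suc i)
  classOf v (centre _)     = inj₂ v

  class : Fin n → Class
  class v = classOf v (locate t (hub v))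

  -- An injective code in ℕ, so that the vertices can be sorted by class.
  encode : Class → ℕ
  encode c = toℕ (join (suc (m T)) n c)

  encode-injective : ∀ {c c′} → encode c ≡ encode c′ → c ≡ c′
  encode-injective {c} {c′} eq = begin
    c                                              ≡⟨ splitAt-join (suc (m T)) n c ⟨
    splitAt (suc (m T)) (join (suc (m T)) n c)     ≡⟨ cong (splitAt (suc (m T))) (toℕ-injective eq) ⟩
    splitAt (suc (m T)) (join (suc (m T)) n c′)    ≡⟨ splitAt-join (suc (m T)) n c′ ⟩
    c′                                             ∎
    where open ≡-Reasoning

  key : Fin n → ℕ
  key = encode ∘ class

  k≤n : k ≤ n
  k≤n = ≤-trans (m≤m+n k k) 2k≤n

  n∸k≤1+k : n ∸ k ≤ suc k
  n∸k≤1+k = begin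
    n ∸ k             ≤⟨ ∸-monoˡ-≤ k n≤2k+1 ⟩
    suc (k + k) ∸ k   ≡⟨ cong (_∸ k) (sym (+-suc k k)) ⟩
    (k + suc k) ∸ k   ≡⟨ m+n∸m≡n k (suc k) ⟩
    suc k             ∎
    where open ≤-Reasoning

  outside-count≤k : count (λ v → ¬? (below? t (hub v))) (allFin n) ≤ k
  outside-count≤k = begin
    c                           ≡⟨ m+n∸m≡n (weight t) c ⟨
    (weight t + c) ∸ weight t   ≡⟨ cong (_∸ weight t) (trans (count-complement (λ v → below? t (hub v)) (allFin n)) (length-allFin n)) ⟩
    n ∸ weight t                ≤⟨ ∸-monoʳ-≤ n t-heavy ⟩
    n ∸ (n ∸ k)                 ≡⟨ m∸[m∸n]≡n k≤n ⟩
    k                           ∎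
    where
    open ≤-Reasoning
    c = count (λ v → ¬? (below? t (hub v))) (allFin n)

  outside-class : ∀ {v} (p : Position t (hub v)) → classOf v p ≡ inj₁ zero → ¬ Below t (hub v)
  outside-class (outside t⋠hub) _ = t⋠hub

  inside-class : ∀ {v i} (p : Position t (hub v)) → classOf v p ≡ inj₁ (suc i) → Below (suc i) (hub v)
  inside-class (inside _ _ i≼hub) refl = i≼hub

  centre-class : ∀ {v w} (p : Position t (hub v)) → classOf v p ≡ inj₂ w → v ≡ w
  centre-class (centre _) refl = refl

  same-class : ∀ {v y} {p : Position t (hub y)} → locate t (hub y) ≡ p → key v ≡ key y → class v ≡ classOf y p
  same-class located kv≡ky = trans (encode-injective kv≡ky) (cong (classOf _) located)

  class-size≤k : ∀ y → multiplicity key (key y) (allFin n) ≤ k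
  class-size≤k y = bound (locate t (hub y)) refl
    where
    open ≤-Reasoning
    same-key? = hasKey? key (key y)
    bound : (p : Position t (hub y)) → locate t (hub y) ≡ p → multiplicity key (key y) (allFin n) ≤ k
    bound (outside _) py = begin
      count same-key? (allFin n)                          ≤⟨ count-mono same-key? _ (outside-class (locate t (hub _)) ∘ same-class py) (allFin n) ⟩
      count (λ v → ¬? (below? t (hub v))) (allFin n)      ≤⟨ outside-count≤k ⟩
      k                                                   ∎
    bound (inside i pᵢ≡t _) py = ≤-pred (begin-strict
      count same-key? (allFin n)                          ≤⟨ count-mono same-key? _ (inside-class (locate t (hub _)) ∘ same-class py) (allFin n) ⟩
      weight (suc i)                                      <⟨ children-light i pᵢ≡t ⟩
      n ∸ k                                               ≤⟨ n∸k≤1+k ⟩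
      suc k                                               ∎)
    bound (centre _) py = begin
      count same-key? (allFin n)                          ≤⟨ count-singleton≤1 same-key? y (centre-class (locate t (hub _)) ∘ same-class py) (Unique.allFin⁺ n) ⟩
      1                                                   ≤⟨ 1≤k ⟩
      k                                                   ∎

  edge∈hub₁ : ∀ u v u≢v → edge u v u≢v ∈ bag D (hub u)
  edge∈hub₁ u v u≢v = hub-bag _ (∈-resp-↭ (↭-sym (endpoints-edge u v u≢v)) (here refl))

  edge∈hub₂ : ∀ u v u≢v → edge u v u≢v ∈ bag D (hub v)
  edge∈hub₂ u v u≢v = hub-bag _ (∈-resp-↭ (↭-sym (endpoints-edge u v u≢v)) (there (here refl)))

  cross-edge-in-bag : ∀ {u v} (pu : Position t (hub u)) (pv : Position t (hub v)) → classOf u pu ≢ classOf v pv →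
                      (u≢v : u ≢ v) → edge u v u≢v ∈ bag D t
  cross-edge-in-bag {u} {v} (centre hub≡t) _ _ u≢v = subst (λ z → _ ∈ bag D z) hub≡t (edge∈hub₁ u v u≢v)
  cross-edge-in-bag {u} {v} _ (centre hub≡t) _ u≢v = subst (λ z → _ ∈ bag D z) hub≡t (edge∈hub₂ u v u≢v)
  cross-edge-in-bag (outside _) (outside _) differ _ = ⊥-elim (differ refl)
  cross-edge-in-bag {u} {v} (outside t⋠u) (inside j pⱼ≡t j≼v) _ u≢v =
    subtree-contains-parent (subtree D _) (edge∈hub₂ u v u≢v) (edge∈hub₁ u v u≢v) j pⱼ≡t j≼v
      (λ j≼u → t⋠u (Below-trans (above-child j pⱼ≡t) j≼u))
  cross-edge-in-bag {u} {v} (inside i pᵢ≡t i≼u) (outside t⋠v) _ u≢v =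
    subtree-contains-parent (subtree D _) (edge∈hub₁ u v u≢v) (edge∈hub₂ u v u≢v) i pᵢ≡t i≼u
      (λ i≼v → t⋠v (Below-trans (above-child i pᵢ≡t) i≼v))
  cross-edge-in-bag {u} {v} (inside i pᵢ≡t i≼u) (inside j pⱼ≡t j≼v) differ u≢v =
    subtree-contains-parent (subtree D _) (edge∈hub₁ u v u≢v) (edge∈hub₂ u v u≢v) i pᵢ≡t i≼u
      (λ i≼v → differ (cong (inj₁ ∘ suc) (siblings-disjoint i≼v j≼v (trans pᵢ≡t (sym pⱼ≡t)))))

  matching-in-bag : Σ (List (LKEdge n)) λ S →
                    SubsetOf (LineGraphK n) S (bag D t) × IsIndependent (LineGraphK n) S × length S ≡ k
  matching-in-bag =
    edges ps distinct
    , All.lookup (All-edges ps distinct (All.map cross keys-differ))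
    , endpoints-unique⇒independent _ (Unique-resp-↭ (↭-sym (allEndpoints-edges ps distinct)) ps-disjoint)
    , trans (length-edges ps distinct) length-ps
    where
    pairing = disjoint-pairs-with-distinct-keys key k (allFin n) (Unique.allFin⁺ n)
                (subst (k + k ≤_) (sym (length-allFin n)) 2k≤n) class-size≤k
    ps = proj₁ pairing
    length-ps = proj₁ (proj₂ pairing)
    ps-disjoint = proj₁ (proj₂ (proj₂ pairing))
    keys-differ = proj₂ (proj₂ (proj₂ pairing))
    distinct : All (uncurry _≢_) ps
    distinct = All.map (λ ku≢kv u≡v → ku≢kv (cong key u≡v)) keys-differ
    cross : ∀ {p} → uncurry (_≢_ on key) p → uncurry (λ u v → (u≢v : u ≢ v) → edge u v u≢v ∈ bag D t) p
    cross {u , v} ku≢kv = cross-edge-in-bag (locate t (hub u)) (locate t (hub v)) (ku≢kv ∘ cong encode)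

single-bag : (G : Graph) (vs : List (V G)) → (∀ v → v ∈ vs) → TreeDecomposition G
single-bag G vs complete = record
  { tree          = record { m = 0 ; parent = λ () ; parent< = λ () }
  ; bag           = λ _ → vs
  ; vertexCovered = λ v → zero , complete v
  ; edgeCovered   = λ u v _ → zero , complete u , complete v
  ; subtree       = λ { _ zero zero _ v∈ → here v∈ }
  }

half-bounds : ∀ n → n / 2 + n / 2 ≤ n × n ≤ suc (n / 2 + n / 2)
half-bounds n = subst (n / 2 + n / 2 ≤_) (sym division) (≤-trans (≤-reflexive (sym double)) (m≤n+m _ (n % 2)))
              , subst (_≤ suc (n / 2 + n / 2)) (sym division) (+-mono-≤ (≤-pred (m%n<n n 2)) (≤-reflexive double))
  where
  division : n ≡ n % 2 + n / 2 * 2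
  division = m≡m%n+[m/n]*n n 2
  double : n / 2 * 2 ≡ n / 2 + n / 2
  double = trans (*-comm (n / 2) 2) (cong (n / 2 +_) (+-identityʳ (n / 2)))

independent⇒length≤n/2 : ∀ n S → IsIndependent (LineGraphK n) S → length S ≤ n / 2
independent⇒length≤n/2 n S indep = begin
  length S             ≡⟨ m*n/n≡m (length S) 2 ⟨
  length S * 2 / 2     ≤⟨ /-monoˡ-≤ 2 (subst (_≤ n) (*-comm 2 (length S)) (independent⇒2*length≤n S indep)) ⟩
  n / 2                ∎
  where open ≤-Reasoning

matching-in-some-bag : ∀ n (D : TreeDecomposition (LineGraphK n)) →
  Σ (Node (tree D)) λ t → Σ (List (LKEdge n)) λ S →
    SubsetOf (LineGraphK n) S (bag D t) × IsIndependent (LineGraphK n) S × length S ≡ n / 2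
matching-in-some-bag n D with n / 2 | half-bounds n
... | zero   | _              = zero , [] , (λ ()) , ([] , λ ()) , refl
... | suc k′ | 2k≤n , n≤2k+1 =
  t , BalancedBag.matching-in-bag n (suc k′) 2k≤n n≤2k+1 (s≤s z≤n) D hub hub-bag t t-heavy children-light
  where
  open CliqueInBag (LineGraphK n) _≟ₑ_ D using (clique-in-bag)
  hub-clique = λ v → clique-in-bag (incidentEdges v) (incidentEdges-clique v)
  hub : Fin n → Node (tree D)
  hub v = proj₁ (hub-clique v)
  hub-bag : ∀ {v} e → v ∈ endpoints e → e ∈ bag D (hub v)
  hub-bag {v} e v∈e = proj₂ (hub-clique v) (incident-∈-incidentEdges e v∈e)
  balanced = Weights.balanced-node (tree D) hub (allFin n) (n ∸ suc k′)
               (subst (n ∸ suc k′ ≤_) (sym (length-allFin n)) (m∸n≤m n (suc k′)))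
  t = proj₁ balanced
  t-heavy = proj₁ (proj₂ balanced)
  children-light = proj₂ (proj₂ balanced)

tree-α≥n/2 : ∀ n (D : TreeDecomposition (LineGraphK n)) j → IsTDIndepNumber (LineGraphK n) D j → n / 2 ≤ j
tree-α≥n/2 n D j (bounded , _) with matching-in-some-bag n D
... | t , S , S⊆t , indep , length-S with bounded t
...   | a , (_ , maximal) , a≤j = ≤-trans (subst (_≤ a) length-S (maximal S S⊆t indep)) a≤j

α-allEdges : ∀ n → IsIndepNumberIn (LineGraphK n) allEdges (n / 2)
α-allEdges n with matching-in-some-bag n (single-bag (LineGraphK n) allEdges ∈-allEdges)
... | _ , S , S⊆ , indep , length-S = (S , S⊆ , indep , length-S) , λ S′ _ indep′ → independent⇒length≤n/2 n S′ indep′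

proposition5p7 : (n : ℕ) → 1 ≤ n →
    IsTreeAlpha (LineGraphK n) (n / 2) × IsIndepNumber (LineGraphK n) (n / 2)
proposition5p7 n _ =
  ( (D₀ , (λ _ → n / 2 , α-allEdges n , ≤-refl) , (zero , α-allEdges n)) , tree-α≥n/2 n )
  , (allEdges , allEdges-unique , ∈-allEdges , α-allEdges n)
  where D₀ = single-bag (LineGraphK n) allEdges ∈-allEdges
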